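{- Let $v,w$ be positive integers. If there exists an MK$(2v+1)$, a resolvable TD$(3,w)$, and a Steiner triple system of order $w$ with chromatic index at most $\frac{1}{2}(w-1)+v$, then there exists a Kirkman triple system of order $2vw+w$ containing a Steiner triple system of order $vw$ as a subdesign.
   Context: An STS$(v)$ is a set of $v$ points with a set of 3-subsets (blocks) such that each pair of distinct points lies in exactly one block; a KTS$(v)$ is an STS$(v)$ whose blocks partition into parallel classes (partitions of the point set); a subdesign is a subset of points with a subset of blocks forming an STS on that subset. MK$(2v+1)$ denotes a KTS$(2v+1)$ containing an STS$(v)$ as a subdesign. A TD$(3,w)$ is a set of $3w$ points partitioned into 3 groups of size $w$ with a set of 3-subsets (blocks) each meeting every group in exactly one point, such that any two points from different groups lie in exactly one block; it is resolvable if its blocks partition into parallel classes. The chromatic index of an STS is the minimum number of classes in a partition of its blocks into partial parallel classes (sets of pairwise disjoint blocks). -}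

module Defs where

open import Data.Nat using (ℕ; suc; _+_; _*_; _∸_; _≤_)
open import Data.Fin using (Fin; zero; suc)
open import Data.Product using (Σ; _×_; _,_; ∃)
open import Data.Sum using (_⊎_)
open import Relation.Binary.PropositionalEquality using (_≡_; _≢_)
open import Relation.Nullary using (¬_)
open import Function.Definitions using (Injective)

∃!ᵢ : {b : ℕ} → (Fin b → Set) → Set
∃!ᵢ {b} P = Σ (Fin b) λ i → P i × (∀ j → P j → j ≡ i)

-- Triple systems on the point set Fin n.
-- A block is a triple (a , b , c) of pairwise distinct points, read as the
-- 3-subset {a,b,c}.  The blocks of a system are indexed by Fin b.

Triple : ℕ → Set
Triple n = Fin n × Fin n × Fin n

_∈ᵗ_ : {n : ℕ} → Fin n → Triple n → Set
x ∈ᵗ (a , b , c) = x ≡ a ⊎ x ≡ b ⊎ x ≡ c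

Distinct : {n : ℕ} → Triple n → Set
Distinct (a , b , c) = a ≢ b × a ≢ c × b ≢ c

record TripleSystem (n : ℕ) : Set where
  field
    nblocks : ℕ
    block   : Fin nblocks → Triple n
open TripleSystem public

-- STS(n): every block is a 3-subset, every pair of distinct points lies in
-- exactly one block (in particular no block is repeated).
IsSTS : {n : ℕ} → TripleSystem n → Set
IsSTS {n} D =
  (∀ i → Distinct (block D i)) ×
  (∀ (x y : Fin n) → x ≢ y → ∃!ᵢ λ i → x ∈ᵗ block D i × y ∈ᵗ block D i)

IsResolution : {n : ℕ} (D : TripleSystem n) (r : ℕ) → (Fin (nblocks D) → Fin r) → Set
IsResolution {n} D r cls =
  ∀ (c : Fin r) (x : Fin n) → ∃!ᵢ λ i → cls i ≡ c × x ∈ᵗ block D i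

IsKTS : {n : ℕ} → TripleSystem n → Set
IsKTS D = IsSTS D × Σ ℕ λ r → Σ (Fin (nblocks D) → Fin r) λ cls → IsResolution D r cls

mapᵗ : {m n : ℕ} → (Fin m → Fin n) → Triple m → Triple n
mapᵗ f (a , b , c) = f a , f b , f c

SameSet : {n : ℕ} → Triple n → Triple n → Set
SameSet s t = (∀ x → x ∈ᵗ s → x ∈ᵗ t) × (∀ x → x ∈ᵗ t → x ∈ᵗ s)

-- D contains an STS(m) as a subdesign: an m-subset of points (the image of
-- an injection Fin m → Fin n) and an STS E on it all of whose blocks are
-- blocks of D.
HasSubSTS : {n : ℕ} → TripleSystem n → ℕ → Set
HasSubSTS {n} D m =
  Σ (Fin m → Fin n) λ f → Injective _≡_ _≡_ f ×
  Σ (TripleSystem m) λ E → IsSTS E ×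
  (∀ j → Σ (Fin (nblocks D)) λ i → SameSet (mapᵗ f (block E j)) (block D i))

-- MK(n): a KTS(n) containing an STS(m) as a subdesign (used with n = 2v+1, m = v).
ExistsKTSWithSub : ℕ → ℕ → Set
ExistsKTSWithSub n m = Σ (TripleSystem n) λ D → IsKTS D × HasSubSTS D m

MK : ℕ → Set
MK v = ExistsKTSWithSub (2 * v + 1) v

ExistsSTS : ℕ → Set
ExistsSTS n = Σ (TripleSystem n) IsSTS

ChromaticIndex≤ : {n : ℕ} → TripleSystem n → ℕ → Set
ChromaticIndex≤ {n} D k =
  Σ (Fin (nblocks D) → Fin k) λ col →
    ∀ i j → i ≢ j → col i ≡ col j → ∀ (x : Fin n) → ¬ (x ∈ᵗ block D i × x ∈ᵗ block D j)

-- The 3w points are Fin 3 × Fin w, the groups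
-- being {g} × Fin w for g : Fin 3.  A block meets each group in exactly one
-- point, so it is given by its three coordinates (one per group).

TDBlock : ℕ → Set
TDBlock w = Fin w × Fin w × Fin w

sel : {w : ℕ} → Fin 3 → TDBlock w → Fin w
sel zero             (a , b , c) = a
sel (suc zero)       (a , b , c) = b
sel (suc (suc zero)) (a , b , c) = c

_∈ᵈ_ : {w : ℕ} → Fin 3 × Fin w → TDBlock w → Set
(g , p) ∈ᵈ B = sel g B ≡ p

record TD3 (w : ℕ) : Set where
  field
    nblocksᵈ : ℕ
    blockᵈ   : Fin nblocksᵈ → TDBlock w
open TD3 public

IsTD3 : {w : ℕ} → TD3 w → Set
IsTD3 {w} T =
  ∀ (g h : Fin 3) → g ≢ h → ∀ (p q : Fin w) →
    ∃!ᵢ λ i → (g , p) ∈ᵈ blockᵈ T i × (h , q) ∈ᵈ blockᵈ T i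

IsResolvableTD3 : {w : ℕ} → TD3 w → Set
IsResolvableTD3 {w} T =
  IsTD3 T ×
  Σ ℕ λ r → Σ (Fin (nblocksᵈ T) → Fin r) λ cls →
    ∀ (c : Fin r) (g : Fin 3) (p : Fin w) →
      ∃!ᵢ λ i → cls i ≡ c × (g , p) ∈ᵈ blockᵈ T i

ExistsResolvableTD3 : ℕ → Set
ExistsResolvableTD3 w = Σ (TD3 w) IsResolvableTD3

-- The design lives on Fin (2v+1) × Fin w.  Its blocks are the blocks of the MK(2v+1) K spread
-- coordinatewise along the blocks of the TD(3,w), plus a copy of the STS(w) S on every row
-- {x} × Fin w: a pair of points in different rows is covered by a product block, a pair in one
-- row by a copy of S.  The same construction applied to the STS(v) inside K is the STS(vw)
-- subdesign.
--
-- Double counting shows that K has v parallel classes and that S is regular of degree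
-- d = (w - 1)/2.  The TD can be relabelled so that one parallel class is the diagonal
-- {(p , p , p)}; a class of K with a non-diagonal class of the TD gives a parallel class.  The
-- remaining blocks, the K-blocks on a diagonal triple and the copies of S, are resolved by
-- colours: S is properly coloured with d + v colours, so exactly v colours miss each point p,
-- and the blocks on the diagonal triple at p coming from the a-th class of K get the a-th colour
-- missing at p.

module Submission where

open import Defs
open import Data.Nat using (ℕ; zero; suc; _+_; _*_; _∸_; _≤_)
open import Data.Nat.Properties
  using (+-0-commutativeMonoid; +-comm; +-identityʳ; +-cancelʳ-≡; *-cancelˡ-≡; *-cancelˡ-≤;
         *-distribˡ-+; *-distribʳ-+; *-identityˡ; m+n∸n≡m; m+n∸m≡n)
open import Data.Fin using (Fin; zero; suc; inject≤; lift; _↑ʳ_)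
open import Data.Fin.Patterns using (0F; 1F; 2F)
open import Data.Fin.Properties
  using (_≟_; any?; 0≢1+n; suc-injective; inject≤-injective; lift-injective; *↔×; +↔⊎)
open import Data.Fin.Permutation using (Permutation; transpose)
open import Data.Product using (Σ; _×_; _,_; ∃; ∃!; proj₁; proj₂; map₁)
open import Data.Product.Properties using (,-injective)
open import Data.Sum using (_⊎_; inj₁; inj₂)
open import Data.Sum.Properties using (inj₂-injective)
open import Data.Sum.Function.Propositional using (_⊎-↔_)
open import Data.Empty using (⊥-elim)
open import Function using (_∘_; _↔_; Inverse; mk↔ₛ′)
open import Function.Definitions using (Injective)
open import Function.Properties.Inverse using (↔-refl; ↔-sym; ↔-trans)
open import Level using (0ℓ)
open import Relation.Nullary using (¬_; Dec; yes; no; contradiction)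
open import Relation.Nullary.Decidable using (_×-dec_; _⊎-dec_; ¬?; map′; dec-true)
open import Relation.Unary using (Pred; Decidable)
open import Relation.Unary.Properties using (∁?)
open import Relation.Binary.PropositionalEquality
  using (_≡_; _≢_; _≗_; refl; sym; trans; cong; cong₂; subst; module ≡-Reasoning)
open import Algebra.Properties.CommutativeMonoid.Sum +-0-commutativeMonoid
  using (sum-syntax; sum-cong-≗; sum-replicate-zero; ∑-distrib-+; ∑-comm)
open ≡-Reasoning

𝟙 : {A : Set} → Dec A → ℕ
𝟙 (yes _) = 1
𝟙 (no _)  = 0

𝟙-yes : {A : Set} (a? : Dec A) → A → 𝟙 a? ≡ 1
𝟙-yes (yes _) _ = refl
𝟙-yes (no ¬a) a = ⊥-elim (¬a a)

𝟙-no : {A : Set} (a? : Dec A) → ¬ A → 𝟙 a? ≡ 0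
𝟙-no (yes a) ¬a = ⊥-elim (¬a a)
𝟙-no (no _)  _  = refl

𝟙+𝟙¬ : {A : Set} (a? : Dec A) → 𝟙 a? + 𝟙 (¬? a?) ≡ 1
𝟙+𝟙¬ (yes _) = refl
𝟙+𝟙¬ (no _)  = refl

𝟙-cong : {A B : Set} → (A → B) → (B → A) → (a? : Dec A) (b? : Dec B) → 𝟙 a? ≡ 𝟙 b?
𝟙-cong A→B B→A (yes a) b? = sym (𝟙-yes b? (A→B a))
𝟙-cong A→B B→A (no ¬a) b? = sym (𝟙-no b? (¬a ∘ B→A))

count : {n : ℕ} {P : Pred (Fin n) 0ℓ} → Decidable P → ℕ
count {n} P? = ∑[ i < n ] 𝟙 (P? i)

∑-const-1 : ∀ n → ∑[ i < n ] 1 ≡ n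
∑-const-1 zero    = refl
∑-const-1 (suc n) = cong suc (∑-const-1 n)

module _ {n : ℕ} {P : Pred (Fin n) 0ℓ} (P? : Decidable P) where

  count-none : (∀ i → ¬ P i) → count P? ≡ 0
  count-none ¬P = trans (sum-cong-≗ (λ i → 𝟙-no (P? i) (¬P i))) (sum-replicate-zero n)

  count+count∁ : count P? + count (∁? P?) ≡ n
  count+count∁ = begin
    count P? + count (∁? P?)               ≡⟨ ∑-distrib-+ (𝟙 ∘ P?) (𝟙 ∘ ∁? P?) ⟨
    ∑[ i < n ] (𝟙 (P? i) + 𝟙 (¬? (P? i)))  ≡⟨ sum-cong-≗ (𝟙+𝟙¬ ∘ P?) ⟩
    ∑[ i < n ] 1                           ≡⟨ ∑-const-1 n ⟩
    n                                      ∎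

count-unique : ∀ {n} {P : Pred (Fin n) 0ℓ} (P? : Decidable P) {i} → P i → (∀ j → P j → j ≡ i) →
               count P? ≡ 1
count-unique {suc n} P? {zero} p unique
  rewrite 𝟙-yes (P? zero) p =
  cong suc (count-none (P? ∘ suc) (λ j q → 0≢1+n (sym (unique (suc j) q))))
count-unique {suc n} P? {suc i} p unique
  rewrite 𝟙-no (P? zero) (λ q → 0≢1+n (unique zero q)) =
  count-unique (P? ∘ suc) p (λ j q → suc-injective (unique (suc j) q))

count-atMostOne : ∀ {n} {P : Pred (Fin n) 0ℓ} (P? : Decidable P) →
                  (∀ i j → P i → P j → i ≡ j) → count P? ≡ 𝟙 (any? P?)
count-atMostOne P? atMostOne with any? P?
... | yes (i , p) = count-unique P? p (λ j q → atMostOne j i q p)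
... | no ∄P       = count-none P? (λ i p → ∄P (i , p))

count-≡ : ∀ {n} (x : Fin n) → count (_≟ x) ≡ 1
count-≡ x = count-unique (_≟ x) refl (λ _ eq → eq)

count-×≡ : ∀ {n} {A : Set} (a? : Dec A) (i : Fin n) → count (λ j → a? ×-dec i ≟ j) ≡ 𝟙 a?
count-×≡ (yes a) i = count-unique (λ j → yes a ×-dec i ≟ j) (a , refl) (λ j q → sym (proj₂ q))
count-×≡ (no ¬a) i = count-none (λ j → no ¬a ×-dec i ≟ j) (λ j q → ¬a (proj₁ q))

record Enumeration {n : ℕ} (P : Pred (Fin n) 0ℓ) (k : ℕ) : Set where
  field
    enum            : Fin k → Fin n
    enum-∈          : ∀ j → P (enum j)
    enum-injective  : Injective _≡_ _≡_ enum
    enum-surjective : ∀ i → P i → ∃ λ j → enum j ≡ i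
open Enumeration public

module _ {n k : ℕ} {P : Pred (Fin (suc n)) 0ℓ} (E : Enumeration (P ∘ suc) k) where

  enumeration-skip : ¬ P zero → Enumeration P k
  enumeration-skip ¬P0 = record
    { enum            = suc ∘ enum E
    ; enum-∈          = enum-∈ E
    ; enum-injective  = enum-injective E ∘ suc-injective
    ; enum-surjective = λ where
        zero    P0 → ⊥-elim (¬P0 P0)
        (suc i) Pi → let j , eq = enum-surjective E i Pi in j , cong suc eq
    }

  enumeration-cons : P zero → Enumeration P (suc k)
  enumeration-cons P0 = record
    { enum            = lift 1 (enum E)
    ; enum-∈          = λ where
        zero    → P0
        (suc j) → enum-∈ E j
    ; enum-injective  = lift-injective (enum E) (enum-injective E) 1
    ; enum-surjective = λ where
        zero    _  → zero , refl
        (suc i) Pi → let j , eq = enum-surjective E i Pi in suc j , cong suc eq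
    }

enumerate : ∀ {n} {P : Pred (Fin n) 0ℓ} (P? : Decidable P) → Enumeration P (count P?)
enumerate {zero}  P? = record
  { enum = λ () ; enum-∈ = λ () ; enum-injective = λ { {()} } ; enum-surjective = λ () }
enumerate {suc n} P? = extend (P? zero)
  where
  extend : (P0? : Dec _) → Enumeration _ (𝟙 P0? + count (P? ∘ suc))
  extend (yes P0) = enumeration-cons (enumerate (P? ∘ suc)) P0
  extend (no ¬P0) = enumeration-skip (enumerate (P? ∘ suc)) ¬P0

_∈ᵗ?_ : {n : ℕ} (x : Fin n) (t : Triple n) → Dec (x ∈ᵗ t)
x ∈ᵗ? (a , b , c) = x ≟ a ⊎-dec x ≟ b ⊎-dec x ≟ c

degree : {n : ℕ} → TripleSystem n → Fin n → ℕ
degree D x = count (λ i → x ∈ᵗ? block D i)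

count-∈ᵗ : ∀ {n} (t : Triple n) → Distinct t → count (_∈ᵗ? t) ≡ 3
count-∈ᵗ {n} t@(a , b , c) distinct = begin
  count (_∈ᵗ? t)
    ≡⟨ sum-cong-≗ (𝟙-∈ᵗ distinct) ⟩
  ∑[ y < n ] (𝟙 (y ≟ a) + (𝟙 (y ≟ b) + 𝟙 (y ≟ c)))
    ≡⟨ ∑-distrib-+ (𝟙 ∘ (_≟ a)) _ ⟩
  count (_≟ a) + ∑[ y < n ] (𝟙 (y ≟ b) + 𝟙 (y ≟ c))
    ≡⟨ cong (count (_≟ a) +_) (∑-distrib-+ (𝟙 ∘ (_≟ b)) (𝟙 ∘ (_≟ c))) ⟩
  count (_≟ a) + (count (_≟ b) + count (_≟ c))
    ≡⟨ cong₂ _+_ (count-≡ a) (cong₂ _+_ (count-≡ b) (count-≡ c)) ⟩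
  3 ∎
  where
  𝟙-∈ᵗ : ∀ {a b c : Fin n} → Distinct (a , b , c) → ∀ y →
         𝟙 (y ∈ᵗ? (a , b , c)) ≡ 𝟙 (y ≟ a) + (𝟙 (y ≟ b) + 𝟙 (y ≟ c))
  𝟙-∈ᵗ {a} {b} {c} (a≢b , a≢c , b≢c) y with y ≟ a | y ≟ b | y ≟ c
  ... | yes refl | yes refl | _        = ⊥-elim (a≢b refl)
  ... | yes refl | no _     | yes refl = ⊥-elim (a≢c refl)
  ... | yes _    | no _     | no _     = refl
  ... | no _     | yes refl | yes refl = ⊥-elim (b≢c refl)
  ... | no _     | yes _    | no _     = refl
  ... | no _     | no _     | yes _    = refl
  ... | no _     | no _     | no _     = refl

degree-resolution : ∀ {n r} {D : TripleSystem n} {cls} → IsResolution D r cls → ∀ x → degree D x ≡ r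
degree-resolution {n} {r} {D} {cls} resolution x = begin
  ∑[ i < nblocks D ] 𝟙 (x ∈ᵗ? block D i)
    ≡⟨ sum-cong-≗ (λ i → count-×≡ (x ∈ᵗ? block D i) (cls i)) ⟨
  ∑[ i < nblocks D ] ∑[ c < r ] 𝟙 (inClass? i c)
    ≡⟨ ∑-comm (λ i c → 𝟙 (inClass? i c)) ⟩
  ∑[ c < r ] ∑[ i < nblocks D ] 𝟙 (inClass? i c)
    ≡⟨ sum-cong-≗ oneBlockPerClass ⟩
  ∑[ c < r ] 1
    ≡⟨ ∑-const-1 r ⟩
  r ∎
  where
  inClass? : ∀ i c → Dec (x ∈ᵗ block D i × cls i ≡ c)
  inClass? i c = x ∈ᵗ? block D i ×-dec cls i ≟ c

  oneBlockPerClass : ∀ c → count (λ i → inClass? i c) ≡ 1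
  oneBlockPerClass c =
    let i , (cls≡c , x∈) , unique = resolution c x in
    count-unique (λ i → inClass? i c) (x∈ , cls≡c)
                 (λ j (x∈′ , cls≡c′) → unique j (cls≡c′ , x∈′))

-- Double count the pairs (i , y) with x and y ≠ x in block i: a block through x contains two
-- such y, and each y ≠ x lies in exactly one block with x.
degree-STS : ∀ {n} {D : TripleSystem n} → IsSTS D → ∀ x → 2 * degree D x + 1 ≡ n
degree-STS {n} {D} (distinct , covered) x = begin
  2 * degree D x + 1
    ≡⟨ cong (λ d → degree D x + d + 1) (+-identityʳ (degree D x)) ⟩
  degree D x + degree D x + 1
    ≡⟨ cong₂ _+_ (∑-distrib-+ x∈? x∈?) (count-≡ x) ⟨
  ∑[ i < nb ] (x∈? i + x∈? i) + count (_≟ x)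
    ≡⟨ cong (_+ count (_≟ x)) (sum-cong-≗ row) ⟨
  ∑[ i < nb ] ∑[ y < n ] 𝟙 (pair? i y) + count (_≟ x)
    ≡⟨ cong (_+ count (_≟ x)) (∑-comm (λ i y → 𝟙 (pair? i y))) ⟩
  ∑[ y < n ] ∑[ i < nb ] 𝟙 (pair? i y) + count (_≟ x)
    ≡⟨ cong (_+ count (_≟ x)) (sum-cong-≗ column) ⟩
  count (∁? (_≟ x)) + count (_≟ x)
    ≡⟨ +-comm (count (∁? (_≟ x))) (count (_≟ x)) ⟩
  count (_≟ x) + count (∁? (_≟ x))
    ≡⟨ count+count∁ (_≟ x) ⟩
  n ∎
  where
  nb : ℕ
  nb = nblocks D

  B : Fin nb → Triple n
  B = block D

  x∈? : Fin nb → ℕ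
  x∈? i = 𝟙 (x ∈ᵗ? B i)

  pair? : ∀ i y → Dec (x ∈ᵗ B i × y ∈ᵗ B i × y ≢ x)
  pair? i y = x ∈ᵗ? B i ×-dec y ∈ᵗ? B i ×-dec ¬? (y ≟ x)

  others-in-block : ∀ i → x ∈ᵗ B i → ∀ y → 𝟙 (pair? i y) + 𝟙 (y ≟ x) ≡ 𝟙 (y ∈ᵗ? B i)
  others-in-block i x∈ y = split (y ≟ x)
    where
    split : (y≟x : Dec (y ≡ x)) → 𝟙 (pair? i y) + 𝟙 y≟x ≡ 𝟙 (y ∈ᵗ? B i)
    split (yes refl) = trans (cong (_+ 1) (𝟙-no (pair? i x) (λ (_ , _ , x≢x) → x≢x refl)))
                             (sym (𝟙-yes (x ∈ᵗ? B i) x∈))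
    split (no y≢x)   = trans (+-identityʳ _)
                             (𝟙-cong (proj₁ ∘ proj₂) (λ y∈ → x∈ , y∈ , y≢x) (pair? i y) (y ∈ᵗ? B i))

  row : ∀ i → count (pair? i) ≡ x∈? i + x∈? i
  row i = split (x ∈ᵗ? B i)
    where
    split : (x∈? : Dec (x ∈ᵗ B i)) → count (pair? i) ≡ 𝟙 x∈? + 𝟙 x∈?
    split (no x∉)  = count-none (pair? i) (λ y (x∈ , _) → x∉ x∈)
    split (yes x∈) = +-cancelʳ-≡ 1 (count (pair? i)) 2 (begin
      count (pair? i) + 1                     ≡⟨ cong (count (pair? i) +_) (count-≡ x) ⟨
      count (pair? i) + count (_≟ x)          ≡⟨ ∑-distrib-+ (𝟙 ∘ pair? i) (𝟙 ∘ (_≟ x)) ⟨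
      ∑[ y < n ] (𝟙 (pair? i y) + 𝟙 (y ≟ x))  ≡⟨ sum-cong-≗ (others-in-block i x∈) ⟩
      count (_∈ᵗ? B i)                        ≡⟨ count-∈ᵗ (B i) (distinct i) ⟩
      3                                       ∎)

  column : ∀ y → count (λ i → pair? i y) ≡ 𝟙 (¬? (y ≟ x))
  column y = split (y ≟ x)
    where
    split : (y≟x : Dec (y ≡ x)) → count (λ i → pair? i y) ≡ 𝟙 (¬? y≟x)
    split (yes y≡x) = count-none (λ i → pair? i y) (λ i (_ , _ , y≢x) → y≢x y≡x)
    split (no y≢x)  =
      let i , (x∈ , y∈) , unique = covered x y (y≢x ∘ sym) in
      count-unique (λ i → pair? i y) (x∈ , y∈ , y≢x)
                   (λ j (x∈′ , y∈′ , _) → unique j (x∈′ , y∈′))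

-- Blocks are taken as maps from the three positions to an arbitrary point type, so that the
-- product designs can be built on Fin m × Fin w and only numbered at the end (by realise).
Block : Set → Set
Block P = Fin 3 → P

_∈ᵇ_ : {P : Set} → P → Block P → Set
x ∈ᵇ B = ∃ λ g → B g ≡ x

module _ {P I : Set} (blk : I → Block P) where

  IsSTSᵇ : Set
  IsSTSᵇ = (∀ i → Injective _≡_ _≡_ (blk i)) ×
           (∀ x y → x ≢ y → ∃! _≡_ λ i → x ∈ᵇ blk i × y ∈ᵇ blk i)

  IsResolutionᵇ : {C : Set} → (I → C) → Set
  IsResolutionᵇ cls = ∀ c x → ∃! _≡_ λ i → cls i ≡ c × x ∈ᵇ blk i

⟦_⟧ : {n : ℕ} → Triple n → Block (Fin n)
⟦ t ⟧ g = sel g t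

⟪_⟫ : {n : ℕ} → Block (Fin n) → Triple n
⟪ B ⟫ = B 0F , B 1F , B 2F

sel-⟪⟫ : ∀ {n} (B : Block (Fin n)) g → sel g ⟪ B ⟫ ≡ B g
sel-⟪⟫ B 0F = refl
sel-⟪⟫ B 1F = refl
sel-⟪⟫ B 2F = refl

∈ᵗ⇒∈ᵇ : ∀ {n} {x : Fin n} t → x ∈ᵗ t → x ∈ᵇ ⟦ t ⟧
∈ᵗ⇒∈ᵇ _ (inj₁ x≡a)        = 0F , sym x≡a
∈ᵗ⇒∈ᵇ _ (inj₂ (inj₁ x≡b)) = 1F , sym x≡b
∈ᵗ⇒∈ᵇ _ (inj₂ (inj₂ x≡c)) = 2F , sym x≡c

∈ᵇ⇒∈ᵗ : ∀ {n} {x : Fin n} t → x ∈ᵇ ⟦ t ⟧ → x ∈ᵗ t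
∈ᵇ⇒∈ᵗ _ (0F , a≡x) = inj₁ (sym a≡x)
∈ᵇ⇒∈ᵗ _ (1F , b≡x) = inj₂ (inj₁ (sym b≡x))
∈ᵇ⇒∈ᵗ _ (2F , c≡x) = inj₂ (inj₂ (sym c≡x))

∈⟪⟫⇒∈ᵇ : ∀ {n} {x : Fin n} B → x ∈ᵗ ⟪ B ⟫ → x ∈ᵇ B
∈⟪⟫⇒∈ᵇ B x∈ = let g , eq = ∈ᵗ⇒∈ᵇ ⟪ B ⟫ x∈ in
  g , trans (sym (sel-⟪⟫ B g)) eq

∈ᵇ⇒∈⟪⟫ : ∀ {n} {x : Fin n} B → x ∈ᵇ B → x ∈ᵗ ⟪ B ⟫
∈ᵇ⇒∈⟪⟫ B (g , eq) = ∈ᵇ⇒∈ᵗ ⟪ B ⟫ (g , trans (sel-⟪⟫ B g) eq)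

Distinct⇒injective : ∀ {n} (t : Triple n) → Distinct t → Injective _≡_ _≡_ ⟦ t ⟧
Distinct⇒injective t _                 {0F} {0F} _  = refl
Distinct⇒injective t _                 {1F} {1F} _  = refl
Distinct⇒injective t _                 {2F} {2F} _  = refl
Distinct⇒injective t (a≢b , _   , _  ) {0F} {1F} eq = contradiction eq a≢b
Distinct⇒injective t (_   , a≢c , _  ) {0F} {2F} eq = contradiction eq a≢c
Distinct⇒injective t (a≢b , _   , _  ) {1F} {0F} eq = contradiction (sym eq) a≢b
Distinct⇒injective t (_   , _   , b≢c) {1F} {2F} eq = contradiction eq b≢c
Distinct⇒injective t (_   , a≢c , _  ) {2F} {0F} eq = contradiction (sym eq) a≢c
Distinct⇒injective t (_   , _   , b≢c) {2F} {1F} eq = contradiction (sym eq) b≢c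

injective⇒Distinct : ∀ {n} (B : Block (Fin n)) → Injective _≡_ _≡_ B → Distinct ⟪ B ⟫
injective⇒Distinct B injective = (λ ()) ∘ injective , (λ ()) ∘ injective , (λ ()) ∘ injective

IsSTS⇒IsSTSᵇ : ∀ {n} {D : TripleSystem n} → IsSTS D → IsSTSᵇ (⟦_⟧ ∘ block D)
IsSTS⇒IsSTSᵇ {D = D} (distinct , covered) =
  (λ i → Distinct⇒injective (block D i) (distinct i)) ,
  λ x y x≢y → let i , (x∈ , y∈) , unique = covered x y x≢y in
    i , (∈ᵗ⇒∈ᵇ (block D i) x∈ , ∈ᵗ⇒∈ᵇ (block D i) y∈) ,
    λ {j} (x∈′ , y∈′) →
      sym (unique j (∈ᵇ⇒∈ᵗ (block D j) x∈′ , ∈ᵇ⇒∈ᵗ (block D j) y∈′))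

IsResolution⇒IsResolutionᵇ : ∀ {n r} {D : TripleSystem n} {cls} → IsResolution D r cls →
                              IsResolutionᵇ (⟦_⟧ ∘ block D) cls
IsResolution⇒IsResolutionᵇ {D = D} resolution c x =
  let i , (cls≡c , x∈) , unique = resolution c x in
  i , (cls≡c , ∈ᵗ⇒∈ᵇ (block D i) x∈) ,
  λ {j} (cls≡c′ , x∈′) → sym (unique j (cls≡c′ , ∈ᵇ⇒∈ᵗ (block D j) x∈′))

⟪⟫-cong : ∀ {n} {B B′ : Block (Fin n)} → B ≗ B′ → ⟪ B ⟫ ≡ ⟪ B′ ⟫
⟪⟫-cong B≗B′ = cong₂ _,_ (B≗B′ 0F) (cong₂ _,_ (B≗B′ 1F) (B≗B′ 2F))

SameSet-≡ : ∀ {n} {s t : Triple n} → s ≡ t → SameSet s t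
SameSet-≡ refl = (λ _ x∈ → x∈) , (λ _ x∈ → x∈)

module _ {P I C : Set} (blk : I → Block P) (col : I → C) where

  ColourAtᵇ : C → P → Set
  ColourAtᵇ c x = ∃ λ i → x ∈ᵇ blk i × col i ≡ c

  IsProperColouringᵇ : Set
  IsProperColouringᵇ = ∀ {i j x} → col i ≡ col j → x ∈ᵇ blk i → x ∈ᵇ blk j → i ≡ j

IsProperColouring : {n k : ℕ} (D : TripleSystem n) → (Fin (nblocks D) → Fin k) → Set
IsProperColouring {n} D col =
  ∀ i j → i ≢ j → col i ≡ col j → ∀ (x : Fin n) → ¬ (x ∈ᵗ block D i × x ∈ᵗ block D j)

_∈ᵇ?_ : ∀ {n} (x : Fin n) t → Dec (x ∈ᵇ ⟦ t ⟧)
x ∈ᵇ? t = map′ (∈ᵗ⇒∈ᵇ t) (∈ᵇ⇒∈ᵗ t) (x ∈ᵗ? t)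

module _ {n k : ℕ} {D : TripleSystem n} {col : Fin (nblocks D) → Fin k} where

  IsProperColouring⇒IsProperColouringᵇ : IsProperColouring D col →
                                         IsProperColouringᵇ (⟦_⟧ ∘ block D) col
  IsProperColouring⇒IsProperColouringᵇ proper {i} {j} {x} col≡ x∈i x∈j with i ≟ j
  ... | yes i≡j = i≡j
  ... | no  i≢j =
    contradiction (∈ᵇ⇒∈ᵗ (block D i) x∈i , ∈ᵇ⇒∈ᵗ (block D j) x∈j) (proper i j i≢j col≡ x)

  colourAt? : ∀ c x → Dec (ColourAtᵇ (⟦_⟧ ∘ block D) col c x)
  colourAt? c x = any? (λ i → x ∈ᵇ? block D i ×-dec col i ≟ c)

  count-colourAt : IsProperColouringᵇ (⟦_⟧ ∘ block D) col → ∀ x →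
                   count (λ c → colourAt? c x) ≡ degree D x
  count-colourAt proper x = begin
    ∑[ c < k ] 𝟙 (colourAt? c x)
      ≡⟨ sum-cong-≗ (λ c → count-atMostOne (colour? c) (atMostOne c)) ⟨
    ∑[ c < k ] ∑[ i < nblocks D ] 𝟙 (colour? c i)
      ≡⟨ ∑-comm (λ c i → 𝟙 (colour? c i)) ⟩
    ∑[ i < nblocks D ] ∑[ c < k ] 𝟙 (colour? c i)
      ≡⟨ sum-cong-≗ (λ i → count-×≡ (x ∈ᵇ? block D i) (col i)) ⟩
    ∑[ i < nblocks D ] 𝟙 (x ∈ᵇ? block D i)
      ≡⟨ sum-cong-≗ (λ i → 𝟙-cong (∈ᵇ⇒∈ᵗ (block D i)) (∈ᵗ⇒∈ᵇ (block D i)) _ _) ⟩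
    degree D x ∎
    where
    colour? : ∀ c i → Dec (x ∈ᵇ ⟦ block D i ⟧ × col i ≡ c)
    colour? c i = x ∈ᵇ? block D i ×-dec col i ≟ c

    atMostOne : ∀ c i j → x ∈ᵇ ⟦ block D i ⟧ × col i ≡ c →
                          x ∈ᵇ ⟦ block D j ⟧ × col j ≡ c → i ≡ j
    atMostOne c i j (x∈i , coli≡c) (x∈j , colj≡c) = proper (trans coli≡c (sym colj≡c)) x∈i x∈j

  count-missingColours : IsProperColouringᵇ (⟦_⟧ ∘ block D) col → ∀ x →
                         count (∁? (λ c → colourAt? c x)) + degree D x ≡ k
  count-missingColours proper x = begin
    count (∁? colourAt?ₓ) + degree D x
      ≡⟨ cong (count (∁? colourAt?ₓ) +_) (count-colourAt proper x) ⟨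
    count (∁? colourAt?ₓ) + count colourAt?ₓ
      ≡⟨ +-comm (count (∁? colourAt?ₓ)) (count colourAt?ₓ) ⟩
    count colourAt?ₓ + count (∁? colourAt?ₓ)
      ≡⟨ count+count∁ colourAt?ₓ ⟩
    k ∎
    where
    colourAt?ₓ : ∀ c → Dec (ColourAtᵇ (⟦_⟧ ∘ block D) col c x)
    colourAt?ₓ c = colourAt? c x

  missingColours : IsProperColouringᵇ (⟦_⟧ ∘ block D) col → ∀ x →
                   Enumeration (λ c → ¬ ColourAtᵇ (⟦_⟧ ∘ block D) col c x) (k ∸ degree D x)
  missingColours proper x =
    subst (Enumeration _) count≡ (enumerate (∁? (λ c → colourAt? c x)))
    where
    count≡ : count (∁? (λ c → colourAt? c x)) ≡ k ∸ degree D x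
    count≡ = trans (sym (m+n∸n≡m _ (degree D x)))
                   (cong (_∸ degree D x) (count-missingColours proper x))

record MissingColouring {w : ℕ} (S : TripleSystem w) (v : ℕ) : Set where
  field
    colours : ℕ
    colour  : Fin (nblocks S) → Fin colours
    proper  : IsProperColouringᵇ (⟦_⟧ ∘ block S) colour
    missing : ∀ t → Enumeration (λ c → ¬ ColourAtᵇ (⟦_⟧ ∘ block S) colour c t) v

module _ {A B : Set} (e : A ↔ B) where
  open Inverse e

  to-injective : Injective _≡_ _≡_ to
  to-injective {x} {y} eq =
    trans (sym (strictlyInverseʳ x)) (trans (cong from eq) (strictlyInverseʳ y))

  from-injective : Injective _≡_ _≡_ from
  from-injective {x} {y} eq =
    trans (sym (strictlyInverseˡ x)) (trans (cong to eq) (strictlyInverseˡ y))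

∃!-transport : ∀ {I : Set} {M : ℕ} (ι : I ↔ Fin M) {Q : I → Set} {R : Fin M → Set} →
               (∀ {i} → Q i → R (Inverse.to ι i)) → (∀ {j} → R j → Q (Inverse.from ι j)) →
               ∃! _≡_ Q → ∃!ᵢ R
∃!-transport ι Q⇒R R⇒Q (i , q , unique) =
  to i , Q⇒R q , λ j r → trans (sym (strictlyInverseˡ j)) (cong to (sym (unique (R⇒Q r))))
  where open Inverse ι

module _ {P I : Set} {N M : ℕ} (points : P ↔ Fin N) (indices : I ↔ Fin M) where
  open Inverse points using () renaming (to to ⌜_⌝; from to ⌞_⌟)
  open Inverse indices using () renaming (to to ⌜_⌝ᵢ; from to ⌞_⌟ᵢ; strictlyInverseʳ to ⌞⌜⌝⌟ᵢ)

  realise : (I → Block P) → TripleSystem N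
  realise blk = record { nblocks = M ; block = λ j → ⟪ ⌜_⌝ ∘ blk ⌞ j ⌟ᵢ ⟫ }

  module _ (blk : I → Block P) where

    ∈-realise⇒ : ∀ {x j} → x ∈ᵗ block (realise blk) j → ⌞ x ⌟ ∈ᵇ blk ⌞ j ⌟ᵢ
    ∈-realise⇒ {x} {j} x∈ =
      let g , eq = ∈⟪⟫⇒∈ᵇ (⌜_⌝ ∘ blk ⌞ j ⌟ᵢ) x∈ in
      g , trans (sym (Inverse.strictlyInverseʳ points (blk ⌞ j ⌟ᵢ g))) (cong ⌞_⌟ eq)

    ∈-realise⇐ : ∀ {x i} → ⌞ x ⌟ ∈ᵇ blk i → x ∈ᵗ block (realise blk) ⌜ i ⌝ᵢ
    ∈-realise⇐ {x} {i} (g , eq) =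
      ∈ᵇ⇒∈⟪⟫ (⌜_⌝ ∘ blk ⌞ ⌜ i ⌝ᵢ ⌟ᵢ)
        (g , trans (cong (λ i′ → ⌜ blk i′ g ⌝) (⌞⌜⌝⌟ᵢ i))
                   (trans (cong ⌜_⌝ eq) (Inverse.strictlyInverseˡ points x)))

    realise-isSTS : IsSTSᵇ blk → IsSTS (realise blk)
    realise-isSTS (injective , covered) =
      (λ j → injective⇒Distinct (⌜_⌝ ∘ blk ⌞ j ⌟ᵢ) (injective ⌞ j ⌟ᵢ ∘ to-injective points)) ,
      λ x y x≢y → ∃!-transport indices
        (λ (x∈ , y∈) → ∈-realise⇐ x∈ , ∈-realise⇐ y∈)
        (λ (x∈ , y∈) → ∈-realise⇒ x∈ , ∈-realise⇒ y∈)
        (covered ⌞ x ⌟ ⌞ y ⌟ (x≢y ∘ from-injective points))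

    realise-isResolution : ∀ {C R} (classes : C ↔ Fin R) {cls : I → C} → IsResolutionᵇ blk cls →
                           IsResolution (realise blk) R (Inverse.to classes ∘ cls ∘ ⌞_⌟ᵢ)
    realise-isResolution classes {cls} resolution c x =
      ∃!-transport indices
        (λ {i} (cls≡ , x∈) → class⇐ i cls≡ , ∈-realise⇐ x∈)
        (λ {j} (cls≡ , x∈) → class⇒ j cls≡ , ∈-realise⇒ x∈)
        (resolution ⌞ c ⌟ᶜ ⌞ x ⌟)
      where
      open Inverse classes using () renaming (to to ⌜_⌝ᶜ; from to ⌞_⌟ᶜ)

      class⇐ : ∀ i → cls i ≡ ⌞ c ⌟ᶜ → ⌜ cls ⌞ ⌜ i ⌝ᵢ ⌟ᵢ ⌝ᶜ ≡ c
      class⇐ i cls≡ = trans (cong (⌜_⌝ᶜ ∘ cls) (⌞⌜⌝⌟ᵢ i))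
                            (trans (cong ⌜_⌝ᶜ cls≡) (Inverse.strictlyInverseˡ classes c))

      class⇒ : ∀ j → ⌜ cls ⌞ j ⌟ᵢ ⌝ᶜ ≡ c → cls ⌞ j ⌟ᵢ ≡ ⌞ c ⌟ᶜ
      class⇒ j cls≡ = trans (sym (Inverse.strictlyInverseʳ classes (cls ⌞ j ⌟ᵢ))) (cong ⌞_⌟ᶜ cls≡)

realise-hasSubSTS :
  ∀ {P I P₂ I₂ : Set} {N M N₂ M₂ : ℕ} (points : P ↔ Fin N) (indices : I ↔ Fin M)
    (points₂ : P₂ ↔ Fin N₂) (indices₂ : I₂ ↔ Fin M₂)
    {blk : I → Block P} {blk₂ : I₂ → Block P₂} → IsSTSᵇ blk₂ →
    (f : P₂ → P) → Injective _≡_ _≡_ f →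
    (φ : I₂ → I) → (∀ b → f ∘ blk₂ b ≗ blk (φ b)) →
    HasSubSTS (realise points indices blk) N₂
realise-hasSubSTS {N₂ = N₂} points indices points₂ indices₂ {blk} {blk₂} isSTS₂
                  f f-injective φ f∘blk₂≗blk∘φ =
  F , F-injective ,
  realise points₂ indices₂ blk₂ , realise-isSTS points₂ indices₂ blk₂ isSTS₂ ,
  λ j → ⌜ φ (⌞ j ⌟₂ᵢ) ⌝ᵢ , SameSet-≡ (⟪⟫-cong (image j))
  where
  open Inverse points using () renaming (to to ⌜_⌝; from to ⌞_⌟)
  open Inverse indices using () renaming (to to ⌜_⌝ᵢ; from to ⌞_⌟ᵢ; strictlyInverseʳ to ⌞⌜⌝⌟ᵢ)
  open Inverse points₂ using () renaming (to to ⌜_⌝₂; from to ⌞_⌟₂; strictlyInverseʳ to ⌞⌜⌝⌟₂)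
  open Inverse indices₂ using () renaming (from to ⌞_⌟₂ᵢ)

  F : Fin N₂ → Fin _
  F = ⌜_⌝ ∘ f ∘ ⌞_⌟₂

  F-injective : Injective _≡_ _≡_ F
  F-injective = from-injective points₂ ∘ f-injective ∘ to-injective points

  image : ∀ j → F ∘ ⌜_⌝₂ ∘ blk₂ ⌞ j ⌟₂ᵢ ≗ ⌜_⌝ ∘ blk ⌞ ⌜ φ ⌞ j ⌟₂ᵢ ⌝ᵢ ⌟ᵢ
  image j g = cong ⌜_⌝ (begin
    f ⌞ ⌜ blk₂ ⌞ j ⌟₂ᵢ g ⌝₂ ⌟₂  ≡⟨ cong f (⌞⌜⌝⌟₂ _) ⟩
    f (blk₂ ⌞ j ⌟₂ᵢ g)          ≡⟨ f∘blk₂≗blk∘φ ⌞ j ⌟₂ᵢ g ⟩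
    blk (φ ⌞ j ⌟₂ᵢ) g           ≡⟨ cong (λ i → blk i g) (⌞⌜⌝⌟ᵢ _) ⟨
    blk ⌞ ⌜ φ ⌞ j ⌟₂ᵢ ⌝ᵢ ⌟ᵢ g   ∎)

IsTD3Resolution : {w : ℕ} (T : TD3 w) (r : ℕ) → (Fin (nblocksᵈ T) → Fin r) → Set
IsTD3Resolution {w} T r cls =
  ∀ (c : Fin r) (g : Fin 3) (p : Fin w) → ∃!ᵢ λ i → cls i ≡ c × (g , p) ∈ᵈ blockᵈ T i

record DiagonallyResolvedTD3 (w : ℕ) : Set where
  field
    td           : TD3 w
    isTD3        : IsTD3 td
    r            : ℕ
    class        : Fin (nblocksᵈ td) → Fin (suc r)
    isResolution : IsTD3Resolution td (suc r) class
    diagonal     : ∀ i → class i ≡ zero → ∀ g → sel g (blockᵈ td i) ≡ sel zero (blockᵈ td i)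

relabelGroups : ∀ {w} → (Fin 3 → Fin w → Fin w) → TD3 w → TD3 w
relabelGroups σ T = record
  { nblocksᵈ = nblocksᵈ T
  ; blockᵈ   = λ i → ⟪ (λ g → σ g (sel g (blockᵈ T i))) ⟫
  }

sel-relabelGroups : ∀ {w} (σ : Fin 3 → Fin w → Fin w) (T : TD3 w) i g →
                    sel g (blockᵈ (relabelGroups σ T) i) ≡ σ g (sel g (blockᵈ T i))
sel-relabelGroups σ T i = sel-⟪⟫ (λ g → σ g (sel g (blockᵈ T i)))

module _ {w : ℕ} (σ : Fin 3 → Fin w ↔ Fin w) (T : TD3 w) where
  private
    T′ : TD3 w
    T′ = relabelGroups (Inverse.to ∘ σ) T

    ∈-relabel⇐ : ∀ {g p i} → (g , Inverse.from (σ g) p) ∈ᵈ blockᵈ T i →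
                 (g , p) ∈ᵈ blockᵈ T′ i
    ∈-relabel⇐ {g} {p} {i} eq = begin
      sel g (blockᵈ T′ i)                      ≡⟨ sel-relabelGroups (Inverse.to ∘ σ) T i g ⟩
      Inverse.to (σ g) (sel g (blockᵈ T i))    ≡⟨ cong (Inverse.to (σ g)) eq ⟩
      Inverse.to (σ g) (Inverse.from (σ g) p)  ≡⟨ Inverse.strictlyInverseˡ (σ g) p ⟩
      p                                        ∎

    ∈-relabel⇒ : ∀ {g p i} → (g , p) ∈ᵈ blockᵈ T′ i →
                 (g , Inverse.from (σ g) p) ∈ᵈ blockᵈ T i
    ∈-relabel⇒ {g} {p} {i} eq = begin
      sel g (blockᵈ T i)
        ≡⟨ Inverse.strictlyInverseʳ (σ g) _ ⟨
      Inverse.from (σ g) (Inverse.to (σ g) (sel g (blockᵈ T i)))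
        ≡⟨ cong (Inverse.from (σ g)) (sel-relabelGroups (Inverse.to ∘ σ) T i g) ⟨
      Inverse.from (σ g) (sel g (blockᵈ T′ i))
        ≡⟨ cong (Inverse.from (σ g)) eq ⟩
      Inverse.from (σ g) p ∎

  relabelGroups-isTD3 : IsTD3 T → IsTD3 T′
  relabelGroups-isTD3 isTD3 g h g≢h p q =
    let i , (p∈ , q∈) , unique = isTD3 g h g≢h (Inverse.from (σ g) p) (Inverse.from (σ h) q) in
    i , (∈-relabel⇐ p∈ , ∈-relabel⇐ q∈) ,
    λ j (p∈′ , q∈′) → unique j (∈-relabel⇒ p∈′ , ∈-relabel⇒ q∈′)

  relabelGroups-isResolution : ∀ {r cls} → IsTD3Resolution T r cls → IsTD3Resolution T′ r cls
  relabelGroups-isResolution resolution c g p =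
    let i , (cls≡c , p∈) , unique = resolution c g (Inverse.from (σ g) p) in
    i , (cls≡c , ∈-relabel⇐ p∈) ,
    λ j (cls≡c′ , p∈′) → unique j (cls≡c′ , ∈-relabel⇒ p∈′)

relabelClasses-isResolution : ∀ {w r r′} {T : TD3 w} {cls} (π : Permutation r r′) →
  IsTD3Resolution T r cls → IsTD3Resolution T r′ (Inverse.to π ∘ cls)
relabelClasses-isResolution π resolution c g p =
  let i , (cls≡c , p∈) , unique = resolution (Inverse.from π c) g p in
  i , (trans (cong (Inverse.to π) cls≡c) (Inverse.strictlyInverseˡ π c) , p∈) ,
  λ j (cls≡c′ , p∈′) →
    unique j (trans (sym (Inverse.strictlyInverseʳ π _)) (cong (Inverse.from π) cls≡c′) , p∈′)

transpose-moves : ∀ {n} (i j : Fin n) → Inverse.to (transpose i j) i ≡ j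
transpose-moves i j rewrite dec-true (i ≟ i) refl = refl

-- Renaming each point (g , q) to the group-0 point of the c₀-block through it makes all c₀-blocks
-- diagonal; transposing the class labels c₀ and 0 then makes c₀ the class 0.
module _ {w r : ℕ} (T : TD3 w) (isTD3 : IsTD3 T) (cls : Fin (nblocksᵈ T) → Fin (suc r))
         (resolution : IsTD3Resolution T (suc r) cls) (c₀ : Fin (suc r)) where
  private
    B : Fin (nblocksᵈ T) → TDBlock w
    B = blockᵈ T

    through : Fin 3 → Fin w → Fin (nblocksᵈ T)
    through g p = proj₁ (resolution c₀ g p)

    through-class : ∀ g p → cls (through g p) ≡ c₀
    through-class g p = proj₁ (proj₁ (proj₂ (resolution c₀ g p)))

    through-∈ : ∀ g p → sel g (B (through g p)) ≡ p
    through-∈ g p = proj₂ (proj₁ (proj₂ (resolution c₀ g p)))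

    through-unique : ∀ {g p j} → cls j ≡ c₀ → sel g (B j) ≡ p → j ≡ through g p
    through-unique {g} {p} {j} cls≡ p∈ = proj₂ (proj₂ (resolution c₀ g p)) j (cls≡ , p∈)

    π ρ : Fin 3 → Fin w → Fin w
    π g q = sel 0F (B (through g q))
    ρ g p = sel g (B (through 0F p))

    π-on-class : ∀ {i} g → cls i ≡ c₀ → π g (sel g (B i)) ≡ sel 0F (B i)
    π-on-class {i} g cls≡ = cong (sel 0F ∘ B) (sym (through-unique cls≡ refl))

    π∘ρ : ∀ g p → π g (ρ g p) ≡ p
    π∘ρ g p = trans (π-on-class g (through-class 0F p)) (through-∈ 0F p)

    ρ∘π : ∀ g q → ρ g (π g q) ≡ q
    ρ∘π g q = trans (cong (sel g ∘ B) (sym (through-unique (through-class g q) refl))) (through-∈ g q)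

    σ : Fin 3 → Fin w ↔ Fin w
    σ g = mk↔ₛ′ (π g) (ρ g) (π∘ρ g) (ρ∘π g)

    swap₀ : Permutation (suc r) (suc r)
    swap₀ = transpose c₀ zero

  diagonalise : DiagonallyResolvedTD3 w
  diagonalise = record
    { td           = relabelGroups π T
    ; isTD3        = relabelGroups-isTD3 σ T isTD3
    ; r            = r
    ; class        = Inverse.to swap₀ ∘ cls
    ; isResolution = relabelGroups-isResolution σ T (relabelClasses-isResolution swap₀ resolution)
    ; diagonal     = diagonal
    }
    where
    T′ : TD3 w
    T′ = relabelGroups π T

    diagonal : ∀ i → Inverse.to swap₀ (cls i) ≡ zero → ∀ g →
               sel g (blockᵈ T′ i) ≡ sel 0F (blockᵈ T′ i)
    diagonal i class≡0 g = begin
      sel g (blockᵈ T′ i)     ≡⟨ sel-relabelGroups π T i g ⟩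
      π g (sel g (B i))       ≡⟨ π-on-class g cls≡c₀ ⟩
      sel 0F (B i)            ≡⟨ π-on-class 0F cls≡c₀ ⟨
      π 0F (sel 0F (B i))     ≡⟨ sel-relabelGroups π T i 0F ⟨
      sel 0F (blockᵈ T′ i)    ∎
      where
      cls≡c₀ : cls i ≡ c₀
      cls≡c₀ = to-injective swap₀ (trans class≡0 (sym (transpose-moves c₀ zero)))

resolvable⇒diagonallyResolved : ∀ {w} → ExistsResolvableTD3 (suc w) →
                                DiagonallyResolvedTD3 (suc w)
resolvable⇒diagonallyResolved (T , isTD3 , r′ , cls , resolution) =
  let i , _ = isTD3 0F 1F (λ ()) zero zero in pick r′ cls resolution (cls i)
  where
  pick : ∀ r′ cls → IsTD3Resolution T r′ cls → Fin r′ → DiagonallyResolvedTD3 _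
  pick zero    _   _          ()
  pick (suc r) cls resolution c₀ = diagonalise T isTD3 cls resolution c₀

module _ {m n : ℕ} (f : Fin m → Fin n) where

  ∈-mapᵗ⁺ : ∀ {x} t → x ∈ᵗ t → f x ∈ᵗ mapᵗ f t
  ∈-mapᵗ⁺ _ (inj₁ refl)        = inj₁ refl
  ∈-mapᵗ⁺ _ (inj₂ (inj₁ refl)) = inj₂ (inj₁ refl)
  ∈-mapᵗ⁺ _ (inj₂ (inj₂ refl)) = inj₂ (inj₂ refl)

  ∈-mapᵗ⁻ : ∀ {y} t → y ∈ᵗ mapᵗ f t → ∃ λ x → x ∈ᵗ t × f x ≡ y
  ∈-mapᵗ⁻ (a , _ , _) (inj₁ refl)        = a , inj₁ refl , refl
  ∈-mapᵗ⁻ (_ , b , _) (inj₂ (inj₁ refl)) = b , inj₂ (inj₁ refl) , refl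
  ∈-mapᵗ⁻ (_ , _ , c) (inj₂ (inj₂ refl)) = c , inj₂ (inj₂ refl) , refl

-- HasSubSTS matches each block of E with a block of D only as a set; listing the points of every
-- block of E in the order of its block in D makes f commute with the blocks pointwise.
module Subdesign {m n : ℕ} {D : TripleSystem n} (isSTS : IsSTS D)
         (f : Fin m → Fin n) (f-injective : Injective _≡_ _≡_ f)
         (E : TripleSystem m) (isSTSᴱ : IsSTS E)
         (embed : ∀ j → Σ (Fin (nblocks D)) λ i → SameSet (mapᵗ f (block E j)) (block D i)) where

  superBlock : Fin (nblocks E) → Fin (nblocks D)
  superBlock j = proj₁ (embed j)

  private
    preimage : ∀ j g → ∃ λ x → x ∈ᵗ block E j × f x ≡ sel g (block D (superBlock j))
    preimage j g = ∈-mapᵗ⁻ f (block E j)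
      (proj₂ (proj₂ (embed j)) _ (∈ᵇ⇒∈ᵗ (block D (superBlock j)) (g , refl)))

  alignedBlock : Fin (nblocks E) → Block (Fin m)
  alignedBlock j g = proj₁ (preimage j g)

  alignedBlock-image : ∀ j → f ∘ alignedBlock j ≗ ⟦ block D (superBlock j) ⟧
  alignedBlock-image j g = proj₂ (proj₂ (preimage j g))

  private
    ∈-aligned⇒ : ∀ {x j} → x ∈ᵇ alignedBlock j → x ∈ᵗ block E j
    ∈-aligned⇒ {j = j} (g , refl) = proj₁ (proj₂ (preimage j g))

    ∈-aligned⇐ : ∀ {x j} → x ∈ᵗ block E j → x ∈ᵇ alignedBlock j
    ∈-aligned⇐ {x} {j} x∈ =
      let fx∈ = proj₁ (proj₂ (embed j)) (f x) (∈-mapᵗ⁺ f (block E j) x∈)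
          g , eq = ∈ᵗ⇒∈ᵇ (block D (superBlock j)) fx∈
      in g , f-injective (trans (alignedBlock-image j g) eq)

  alignedBlock-isSTS : IsSTSᵇ alignedBlock
  alignedBlock-isSTS = injective , covered
    where
    injective : ∀ j → Injective _≡_ _≡_ (alignedBlock j)
    injective j eq = Distinct⇒injective (block D (superBlock j)) (proj₁ isSTS (superBlock j))
      (trans (sym (alignedBlock-image j _)) (trans (cong f eq) (alignedBlock-image j _)))

    covered : ∀ x y → x ≢ y → ∃! _≡_ λ j → x ∈ᵇ alignedBlock j × y ∈ᵇ alignedBlock j
    covered x y x≢y =
      let j , (x∈ , y∈) , unique = proj₂ isSTSᴱ x y x≢y in
      j , (∈-aligned⇐ x∈ , ∈-aligned⇐ y∈) ,
      λ {j′} (x∈′ , y∈′) → sym (unique j′ (∈-aligned⇒ x∈′ , ∈-aligned⇒ y∈′))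

module _ {m w : ℕ} {IA IS : Set}
         (blkA : IA → Block (Fin m)) (T : TD3 w) (blkS : IS → Block (Fin w)) where

  ProductIndex : Set
  ProductIndex = (IA × Fin (nblocksᵈ T)) ⊎ (Fin m × IS)

  product : ProductIndex → Block (Fin m × Fin w)
  product (inj₁ (β , i)) g = blkA β g , sel g (blockᵈ T i)
  product (inj₂ (x , s)) g = x , blkS s g

  product-tdCoordinate : (∀ β → Injective _≡_ _≡_ (blkA β)) → ∀ {β i k k′ z q} →
                         blkA β k′ ≡ z → product (inj₁ (β , i)) k ≡ (z , q) →
                         sel k′ (blockᵈ T i) ≡ q
  product-tdCoordinate injectiveᴬ {β} {i} βk′≡z e = subst (λ k → sel k (blockᵈ T i) ≡ _)
    (injectiveᴬ β (trans (proj₁ (,-injective e)) (sym βk′≡z))) (proj₂ (,-injective e))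

  module _ (isSTSᴬ : IsSTSᵇ blkA) (isTD3 : IsTD3 T) (isSTSˢ : IsSTSᵇ blkS) where
    private
      injectiveᴬ : ∀ β → Injective _≡_ _≡_ (blkA β)
      injectiveᴬ = proj₁ isSTSᴬ

    product-injective : ∀ b → Injective _≡_ _≡_ (product b)
    product-injective (inj₁ (β , i)) = injectiveᴬ β ∘ proj₁ ∘ ,-injective
    product-injective (inj₂ (x , s)) = proj₁ isSTSˢ s ∘ proj₂ ∘ ,-injective

    product-coversDistinctRows : ∀ {x y} p q → x ≢ y →
      ∃! _≡_ λ b → (x , p) ∈ᵇ product b × (y , q) ∈ᵇ product b
    product-coversDistinctRows {x} {y} p q x≢y with proj₂ isSTSᴬ x y x≢y
    ... | β , ((g , βg≡x) , (h , βh≡y)) , uniqueβ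
        with isTD3 g h (λ g≡h → x≢y (trans (sym βg≡x) (trans (cong (blkA β) g≡h) βh≡y))) p q
    ...   | i , (ig≡p , ih≡q) , uniqueᵢ =
      inj₁ (β , i) , ((g , cong₂ _,_ βg≡x ig≡p) , (h , cong₂ _,_ βh≡y ih≡q)) , unique
      where
      unique : ∀ {b} → (x , p) ∈ᵇ product b × (y , q) ∈ᵇ product b → inj₁ (β , i) ≡ b
      unique {inj₂ (z , s)} ((_ , zx) , (_ , zy)) =
        contradiction (trans (sym (proj₁ (,-injective zx))) (proj₁ (,-injective zy))) x≢y
      unique {inj₁ (β′ , i′)} ((g′ , e₁) , (h′ , e₂))
        with uniqueβ ((g′ , proj₁ (,-injective e₁)) , (h′ , proj₁ (,-injective e₂)))
      ... | refl = cong (λ j → inj₁ (β , j))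
                     (sym (uniqueᵢ i′ (product-tdCoordinate injectiveᴬ βg≡x e₁ ,
                                       product-tdCoordinate injectiveᴬ βh≡y e₂)))

    product-coversSameRow : ∀ x {p q} → p ≢ q →
      ∃! _≡_ λ b → (x , p) ∈ᵇ product b × (x , q) ∈ᵇ product b
    product-coversSameRow x {p} {q} p≢q with proj₂ isSTSˢ p q p≢q
    ... | s , ((g , sg≡p) , (h , sh≡q)) , uniqueₛ =
      inj₂ (x , s) , ((g , cong (x ,_) sg≡p) , (h , cong (x ,_) sh≡q)) , unique
      where
      unique : ∀ {b} → (x , p) ∈ᵇ product b × (x , q) ∈ᵇ product b → inj₂ (x , s) ≡ b
      unique {inj₁ (β , i)} ((g′ , e₁) , (h′ , e₂)) =
        contradiction (trans (sym (proj₂ (,-injective e₁)))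
                             (trans (cong (λ k → sel k (blockᵈ T i)) g′≡h′) (proj₂ (,-injective e₂))))
                      p≢q
        where
        g′≡h′ : g′ ≡ h′
        g′≡h′ = injectiveᴬ β (trans (proj₁ (,-injective e₁)) (sym (proj₁ (,-injective e₂))))
      unique {inj₂ (z , s′)} ((g′ , e₁) , (h′ , e₂)) with proj₁ (,-injective e₁)
      ... | refl = cong (λ t → inj₂ (x , t))
                     (uniqueₛ ((g′ , proj₂ (,-injective e₁)) , (h′ , proj₂ (,-injective e₂))))

    product-isSTS : IsSTSᵇ product
    product-isSTS = product-injective , covers
      where
      covers : ∀ u v → u ≢ v → ∃! _≡_ λ b → u ∈ᵇ product b × v ∈ᵇ product b
      covers (x , p) (y , q) u≢v with x ≟ y
      ... | no  x≢y  = product-coversDistinctRows p q x≢y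
      ... | yes refl = product-coversSameRow x (u≢v ∘ cong (x ,_))

module _ {m₂ m w : ℕ} {IA₂ IA IS : Set} {blkA₂ : IA₂ → Block (Fin m₂)} {blkA : IA → Block (Fin m)}
         (T : TD3 w) (blkS : IS → Block (Fin w))
         (f : Fin m₂ → Fin m) (ψ : IA₂ → IA) where

  mapIndex : ProductIndex blkA₂ T blkS → ProductIndex blkA T blkS
  mapIndex (inj₁ (β , i)) = inj₁ (ψ β , i)
  mapIndex (inj₂ (x , s)) = inj₂ (f x , s)

  product-map : (∀ β → f ∘ blkA₂ β ≗ blkA (ψ β)) →
                ∀ b → map₁ f ∘ product blkA₂ T blkS b ≗ product blkA T blkS (mapIndex b)
  product-map f∘blkA₂≗blkA∘ψ (inj₁ (β , i)) g =
    cong (_, sel g (blockᵈ T i)) (f∘blkA₂≗blkA∘ψ β g)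
  product-map _ (inj₂ (x , s)) g = refl

module ProductResolution {m w v K : ℕ} {IA IS : Set}
         {blkA : IA → Block (Fin m)} {blkS : IS → Block (Fin w)}
         (DR : DiagonallyResolvedTD3 w)
         (injectiveᴬ : ∀ β → Injective _≡_ _≡_ (blkA β))
         (clsA : IA → Fin v) (resolutionᴬ : IsResolutionᵇ blkA clsA)
         (col : IS → Fin K) (proper : IsProperColouringᵇ blkS col)
         (colourAt? : ∀ c t → Dec (ColourAtᵇ blkS col c t))
         (missing : ∀ t → Enumeration (λ c → ¬ ColourAtᵇ blkS col c t) v) where

  open DiagonallyResolvedTD3 DR

  ProductClass : Set
  ProductClass = (Fin v × Fin r) ⊎ Fin K

  -- A-blocks times the diagonal block {(p , p , p)} get, by A-class, the colours missing at p.
  tdBlockClass : Fin v → Fin (suc r) → Fin w → ProductClass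
  tdBlockClass a zero    p = inj₂ (enum (missing p) a)
  tdBlockClass a (suc c) p = inj₁ (a , c)

  productClass : ProductIndex blkA td blkS → ProductClass
  productClass (inj₁ (β , i)) = tdBlockClass (clsA β) (class i) (sel 0F (blockᵈ td i))
  productClass (inj₂ (x , s)) = inj₂ (col s)

  private
    B : Fin (nblocksᵈ td) → TDBlock w
    B = blockᵈ td

    tdBlockClass-inj₁ : ∀ {a c p a′ c′} → tdBlockClass a c p ≡ inj₁ (a′ , c′) →
                        a ≡ a′ × c ≡ suc c′
    tdBlockClass-inj₁ {c = suc _} refl = refl , refl

    tdBlockClass-inj₂ : ∀ {a c p k} → tdBlockClass a c p ≡ inj₂ k →
                        c ≡ zero × enum (missing p) a ≡ k
    tdBlockClass-inj₂ {c = zero} refl = refl , refl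

    diagonal-∈ : ∀ {i q} k → class i ≡ zero → sel k (B i) ≡ q → sel 0F (B i) ≡ q
    diagonal-∈ {i} k class≡0 k∈ = trans (sym (diagonal i class≡0 k)) k∈

  ClassThrough : ProductClass → Fin m × Fin w → ProductIndex blkA td blkS → Set
  ClassThrough c u b = productClass b ≡ c × u ∈ᵇ product blkA td blkS b

  productClass-tdClass : ∀ a c x p → ∃! _≡_ (ClassThrough (inj₁ (a , c)) (x , p))
  productClass-tdClass a c x p with resolutionᴬ a x
  ... | β , (clsβ≡a , (g , βg≡x)) , uniqueβ with isResolution (suc c) g p
  ...   | i , (clsi≡ , ig≡p) , uniqueᵢ =
    inj₁ (β , i) , (class≡ , (g , cong₂ _,_ βg≡x ig≡p)) , unique
    where
    class≡ : productClass (inj₁ (β , i)) ≡ inj₁ (a , c)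
    class≡ rewrite clsβ≡a | clsi≡ = refl

    unique : ∀ {b} → ClassThrough (inj₁ (a , c)) (x , p) b → inj₁ (β , i) ≡ b
    unique {inj₂ _} (() , _)
    unique {inj₁ (β′ , i′)} (class≡′ , (g′ , e)) with tdBlockClass-inj₁ class≡′
    ... | clsβ′≡a , clsi′≡ with uniqueβ (clsβ′≡a , (g′ , proj₁ (,-injective e)))
    ...   | refl = cong (λ j → inj₁ (β , j))
                       (sym (uniqueᵢ i′ (clsi′≡ , product-tdCoordinate blkA td blkS injectiveᴬ βg≡x e)))

  productClass-colourAt : ∀ {k p} x → ColourAtᵇ blkS col k p →
                          ∃! _≡_ (ClassThrough (inj₂ k) (x , p))
  productClass-colourAt {k} {p} x at@(s , (g , sg≡p) , cols≡k) =
    inj₂ (x , s) , (cong inj₂ cols≡k , (g , cong (x ,_) sg≡p)) , unique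
    where
    unique : ∀ {b} → ClassThrough (inj₂ k) (x , p) b → inj₂ (x , s) ≡ b
    unique {inj₂ (z , s′)} (class≡′ , (g′ , e)) with proj₁ (,-injective e)
    ... | refl = cong (λ t → inj₂ (x , t)) (proper (trans cols≡k (sym (inj₂-injective class≡′)))
                                                   (g , sg≡p) (g′ , proj₂ (,-injective e)))
    unique {inj₁ (β , i)} (class≡′ , (g′ , e)) with tdBlockClass-inj₂ class≡′
    ... | class≡0 , missing≡k with diagonal-∈ g′ class≡0 (proj₂ (,-injective e))
    ...   | refl = contradiction (subst (λ c → ColourAtᵇ blkS col c p) (sym missing≡k) at)
                                 (enum-∈ (missing p) (clsA β))

  productClass-colourMissing : ∀ {k p} x → ¬ ColourAtᵇ blkS col k p →
                               ∃! _≡_ (ClassThrough (inj₂ k) (x , p))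
  productClass-colourMissing {k} {p} x ¬at with enum-surjective (missing p) k ¬at
  ... | a , missing≡k with resolutionᴬ a x
  ...   | β , (clsβ≡a , (g , βg≡x)) , uniqueβ with isResolution zero 0F p
  ...     | i , (clsi≡0 , i0≡p) , uniqueᵢ =
    inj₁ (β , i) , (class≡ , (g , cong₂ _,_ βg≡x (trans (diagonal i clsi≡0 g) i0≡p))) , unique
    where
    class≡ : productClass (inj₁ (β , i)) ≡ inj₂ k
    class≡ rewrite clsβ≡a | clsi≡0 | i0≡p = cong inj₂ missing≡k

    unique : ∀ {b} → ClassThrough (inj₂ k) (x , p) b → inj₁ (β , i) ≡ b
    unique {inj₂ (_ , s)} (class≡′ , (g′ , e)) =
      contradiction (s , (g′ , proj₂ (,-injective e)) , inj₂-injective class≡′) ¬at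
    unique {inj₁ (β′ , i′)} (class≡′ , (g′ , e)) with tdBlockClass-inj₂ class≡′
    ... | class≡0′ , missing≡k′ with diagonal-∈ g′ class≡0′ (proj₂ (,-injective e))
    ...   | refl with enum-injective (missing p) (trans missing≡k′ (sym missing≡k))
    ...     | clsβ′≡a with uniqueβ (clsβ′≡a , (g′ , proj₁ (,-injective e)))
    ...       | refl = cong (λ j → inj₁ (β , j)) (sym (uniqueᵢ i′ (class≡0′ , refl)))

  product-isResolution : IsResolutionᵇ (product blkA td blkS) productClass
  product-isResolution (inj₁ (a , c)) (x , p) = productClass-tdClass a c x p
  product-isResolution (inj₂ k)       (x , p) with colourAt? k p
  ... | yes at = productClass-colourAt x at
  ... | no ¬at = productClass-colourMissing x ¬at

private
  Fin×↔ : ∀ {a b} → (Fin a × Fin b) ↔ Fin (a * b)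
  Fin×↔ = ↔-sym *↔×

  Fin⊎↔ : ∀ {A B : Set} {a b} → A ↔ Fin a → B ↔ Fin b → (A ⊎ B) ↔ Fin (a + b)
  Fin⊎↔ A↔ B↔ = ↔-trans (A↔ ⊎-↔ B↔) (↔-sym +↔⊎)

kirkmanProduct :
  ∀ {n m v w} {K : TripleSystem n} {clsK : Fin (nblocks K) → Fin v} →
  IsSTS K → IsResolution K v clsK → HasSubSTS K m →
  DiagonallyResolvedTD3 w →
  (S : TripleSystem w) → IsSTS S → MissingColouring S v →
  ExistsKTSWithSub (n * w) (m * w)
kirkmanProduct {n} {m} {v} {w} {K} {clsK} isSTSᴷ resolutionᴷ (f , f-injective , E , isSTSᴱ , embed)
               DR S isSTSˢ missingColouring =
  realise points indices blocks ,
  (realise-isSTS points indices blocks blocks-isSTS , _ , _ ,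
   realise-isResolution points indices blocks classes product-isResolution) ,
  realise-hasSubSTS points indices Fin×↔ (Fin⊎↔ Fin×↔ Fin×↔) {blocks} {subBlocks} subBlocks-isSTS
    (map₁ f) map₁f-injective
    (mapIndex {blkA₂ = alignedBlock} {blkA = blkK} td blkS f superBlock)
    (product-map td blkS f superBlock alignedBlock-image)
  where
  open DiagonallyResolvedTD3 DR
  open Subdesign isSTSᴷ f f-injective E isSTSᴱ embed
  open MissingColouring missingColouring
  open ProductResolution DR (proj₁ (IsSTS⇒IsSTSᵇ isSTSᴷ)) clsK (IsResolution⇒IsResolutionᵇ resolutionᴷ)
                         colour proper colourAt? missing

  blkK : Fin (nblocks K) → Block (Fin n)
  blkK = ⟦_⟧ ∘ block K

  blkS : Fin (nblocks S) → Block (Fin w)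
  blkS = ⟦_⟧ ∘ block S

  blocks : ProductIndex blkK td blkS → Block (Fin n × Fin w)
  blocks = product blkK td blkS

  blocks-isSTS : IsSTSᵇ blocks
  blocks-isSTS = product-isSTS blkK td blkS (IsSTS⇒IsSTSᵇ isSTSᴷ) isTD3 (IsSTS⇒IsSTSᵇ isSTSˢ)

  subBlocks : ProductIndex alignedBlock td blkS → Block (Fin m × Fin w)
  subBlocks = product alignedBlock td blkS

  subBlocks-isSTS : IsSTSᵇ subBlocks
  subBlocks-isSTS = product-isSTS alignedBlock td blkS alignedBlock-isSTS isTD3 (IsSTS⇒IsSTSᵇ isSTSˢ)

  map₁f-injective : Injective _≡_ _≡_ (map₁ {C = Fin w} f)
  map₁f-injective eq = let x≡y , p≡q = ,-injective eq in cong₂ _,_ (f-injective x≡y) p≡q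

  points : (Fin n × Fin w) ↔ Fin (n * w)
  points = Fin×↔

  indices : ProductIndex blkK td blkS ↔ Fin (nblocks K * nblocksᵈ td + n * nblocks S)
  indices = Fin⊎↔ Fin×↔ Fin×↔

  classes : ProductClass ↔ Fin (v * r + colours)
  classes = Fin⊎↔ Fin×↔ ↔-refl

resolution-size : ∀ {v r} {D : TripleSystem (2 * v + 1)} {cls} →
                  IsSTS D → IsResolution D r cls → r ≡ v
resolution-size {v} {r} {D} isSTS resolution =
  *-cancelˡ-≡ r v 2 (+-cancelʳ-≡ 1 (2 * r) (2 * v) (begin
    2 * r + 1           ≡⟨ cong (λ d → 2 * d + 1) (degree-resolution resolution x) ⟨
    2 * degree D x + 1  ≡⟨ degree-STS isSTS x ⟩
    2 * v + 1           ∎))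
  where
  x : Fin (2 * v + 1)
  x = 2 * v ↑ʳ zero

chromaticIndex⇒missingColouring :
  ∀ {w₀ v k} {S : TripleSystem (suc w₀)} → IsSTS S →
  ChromaticIndex≤ S k → 2 * k ≤ w₀ + 2 * v → MissingColouring S v
chromaticIndex⇒missingColouring {w₀} {v} {k} {S} isSTS (col , proper) 2k≤ = record
  { colours = d + v
  ; colour  = col′
  ; proper  = proper′
  ; missing = missing
  }
  where
  d : ℕ
  d = degree S zero

  w₀≡2d : w₀ ≡ 2 * d
  w₀≡2d = +-cancelʳ-≡ 1 w₀ (2 * d) (trans (+-comm w₀ 1) (sym (degree-STS isSTS zero)))

  k≤d+v : k ≤ d + v
  k≤d+v = *-cancelˡ-≤ 2 (subst (2 * k ≤_) (trans (cong (_+ 2 * v) w₀≡2d) (sym (*-distribˡ-+ 2 d v)))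
                               2k≤)

  col′ : Fin (nblocks S) → Fin (d + v)
  col′ s = inject≤ (col s) k≤d+v

  proper′ : IsProperColouringᵇ (⟦_⟧ ∘ block S) col′
  proper′ = IsProperColouring⇒IsProperColouringᵇ
    (λ i j i≢j col′≡ → proper i j i≢j (inject≤-injective k≤d+v k≤d+v (col i) (col j) col′≡))

  degree≡d : ∀ t → degree S t ≡ d
  degree≡d t = *-cancelˡ-≡ _ _ 2 (+-cancelʳ-≡ 1 _ _
                 (trans (degree-STS isSTS t) (sym (degree-STS isSTS zero))))

  missing : ∀ t → Enumeration (λ c → ¬ ColourAtᵇ (⟦_⟧ ∘ block S) col′ c t) v
  missing t = subst (Enumeration _) (trans (cong (d + v ∸_) (degree≡d t)) (m+n∸m≡n d v))
                    (missingColours proper′ t)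

lemma5p1 : (v w : ℕ) → 1 ≤ v → 1 ≤ w →
    MK v →
    ExistsResolvableTD3 w →
    (Σ (TripleSystem w) λ D → IsSTS D ×
       Σ ℕ λ k → 2 * k ≤ (w ∸ 1) + 2 * v × ChromaticIndex≤ D k) →
    ExistsKTSWithSub (2 * v * w + w) (v * w)
lemma5p1 v zero _ () _ _ _
lemma5p1 v (suc w₀) _ _ (K , (isSTSᴷ , r , clsK , resolutionᴷ) , sub) td (S , isSTSˢ , k , 2k≤ , colouring)
  with resolution-size {v} isSTSᴷ resolutionᴷ
... | refl =
  subst (λ N → ExistsKTSWithSub N (v * w)) size
    (kirkmanProduct isSTSᴷ resolutionᴷ sub (resolvable⇒diagonallyResolved td)
                    S isSTSˢ (chromaticIndex⇒missingColouring isSTSˢ colouring 2k≤))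
  where
  w : ℕ
  w = suc w₀

  size : (2 * v + 1) * w ≡ 2 * v * w + w
  size = trans (*-distribʳ-+ w (2 * v) 1) (cong (2 * v * w +_) (*-identityˡ w))
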